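{- Let $\mathcal A\subseteq\mathbb N$, $L$ an environment and $T,U$ terms. If $L\vdash_{\mathcal A}T:U$, then there exists an arity $A$ such that $L\vdash T::A$ and $L\vdash U::A$.
   Context: Fix a nonempty set $\Sigma$ of sorts with decidable equality, an arbitrary function $\mathrm{next}:\Sigma\to\Sigma$, and a countably infinite set of variables. Terms and environments: $T,U,V,W ::= \star s \mid x \mid \mathrm{app}(V,T) \mid \lambda x{:}W.\,T \mid \mathrm{def}(x{=}V).\,T \mid \mathrm{cast}(U,T)$ ($s\in\Sigma$) and $L,K ::= \emptyset \mid K,x{:}W \mid K,x{=}V$. $\mathrm{app}(V,T)$ applies $T$ to $V$; $\lambda x{:}W.\,T$ (de Bruijn's abstraction) and $\mathrm{def}(x{=}V).\,T$ (local definition) bind $x$ in $T$; $\mathrm{cast}(U,T)$ annotates $T$ with expected type $U$; entries $x{:}W$ and $x{=}V$ bind $x$. Terms are modulo renaming of bound variables. Write $\mathsf{B}x[V]$ for either $\lambda x{:}V$ or $\mathrm{def}(x{=}V)$ and correspondingly $L,x[V]$ for $L,x{:}V$ resp. $L,x{=}V$. One step of bound rt-reduction $L\vdash T_1\to^nT_2$ is the smallest relation closed under: $L\vdash\mathrm{app}(V,\lambda x{:}W.\,T)\to^0\mathrm{def}(x{=}\mathrm{cast}(W,V)).\,T$; $K,x{=}V\vdash x\to^0V$; $L\vdash\mathrm{def}(x{=}V).\,T\to^0T$ if $x$ not free in $T$; $L\vdash\mathrm{app}(V,\mathrm{def}(x{=}W).\,T)\to^0\mathrm{def}(x{=}W).\,\mathrm{app}(V,T)$;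 $L\vdash\mathrm{cast}(U,T)\to^0T$; $L\vdash\star s\to^1\star\,\mathrm{next}(s)$; $K,x{:}W\vdash x\to^1W$; $L\vdash\mathrm{cast}(U,T)\to^1U$; if $K\vdash x\to^nT$, $y\neq x$, $y$ not free in $T$ then $K,y[V]\vdash x\to^nT$; if $L\vdash V_1\to^0V_2$ then $L\vdash\mathrm{app}(V_1,T)\to^0\mathrm{app}(V_2,T)$; if $L\vdash T_1\to^nT_2$ then $L\vdash\mathrm{app}(V,T_1)\to^n\mathrm{app}(V,T_2)$; if $L\vdash V_1\to^0V_2$ then $L\vdash\mathsf Bx[V_1].\,T\to^0\mathsf Bx[V_2].\,T$; if $L,x[V]\vdash T_1\to^nT_2$ then $L\vdash\mathsf Bx[V].\,T_1\to^n\mathsf Bx[V].\,T_2$; if $L\vdash U_1\to^0U_2$ then $L\vdash\mathrm{cast}(U_1,T)\to^0\mathrm{cast}(U_2,T)$; if $L\vdash T_1\to^0T_2$ then $L\vdash\mathrm{cast}(U,T_1)\to^0\mathrm{cast}(U,T_2)$; if $L\vdash U_1\to^1U_2$ and $L\vdash T_1\to^1T_2$ then $L\vdash\mathrm{cast}(U_1,T_1)\to^1\mathrm{cast}(U_2,T_2)$. $L\vdash T_1\to^{*n}T_2$ is the smallest relation with $L\vdash T\to^{*0}T$, containing single steps, and with $L\vdash T_1\to^{*n_1}T$, $L\vdash T\to^{*n_2}T_2$ implying $L\vdash T_1\to^{*n_1+n_2}T_2$. Validity $L\vdash_{\mathcal A}T$ is the smallest predicate closed under: $L\vdash_{\mathcal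 A}\star s$; if $K\vdash_{\mathcal A}V$ then $K,x[V]\vdash_{\mathcal A}x$; if $K\vdash_{\mathcal A}x$ and $y\neq x$ then $K,y[V]\vdash_{\mathcal A}x$; if $L\vdash_{\mathcal A}V$ and $L,x[V]\vdash_{\mathcal A}T$ then $L\vdash_{\mathcal A}\mathsf Bx[V].\,T$; if $L\vdash_{\mathcal A}U$, $L\vdash_{\mathcal A}T$ and some $U_0$ satisfies $L\vdash T\to^{*1}U_0$, $L\vdash U\to^{*0}U_0$, then $L\vdash_{\mathcal A}\mathrm{cast}(U,T)$; if $L\vdash_{\mathcal A}V$, $L\vdash_{\mathcal A}T$ and there are $n\in\mathcal A$, $x,W_0,U_0$ with $L\vdash T\to^{*n}\lambda x{:}W_0.\,U_0$ and $L\vdash V\to^{*1}W_0$, then $L\vdash_{\mathcal A}\mathrm{app}(V,T)$. The type judgment $L\vdash_{\mathcal A}T:U$ means $L\vdash_{\mathcal A}\mathrm{cast}(U,T)$. Arities are $A,B::=\circ\mid B\Rightarrow A$. Arity assignment $L\vdash T::A$ is the smallest relation closed under: $L\vdash\star s::\circ$; if $K\vdash V::A$ then $K,x[V]\vdash x::A$; if $K\vdash x::A$ and $y\neq x$ then $K,y[V]\vdash x::A$; if $L\vdash W::B$ and $L,x{:}W\vdash T::A$ then $L\vdash\lambda x{:}W.\,T::B\Rightarrow A$; if $L\vdash V::B$ and $L,x{=}V\vdash T::A$ then $L\vdash\mathrm{def}(x{=}V).\,T::A$; if $L\vdash V::B$ and $L\vdash T::B\Rightarrow A$ then $L\vdash\mathrm{app}(V,T)::A$;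 if $L\vdash U::A$ and $L\vdash T::A$ then $L\vdash\mathrm{cast}(U,T)::A$. -}

module Defs where

open import Data.Nat using (ℕ; zero; suc; _+_; _<ᵇ_)
open import Data.Bool using (if_then_else_)

-- Variables are represented by de Bruijn indices (terms modulo renaming
-- of bound variables); environments are snoc lists, index 0 = last entry.
module Lang (S : Set) (next : S → S) where

  data BKind : Set where
    lam : BKind
    dfn : BKind

  data Term : Set where
    sort : S → Term
    var  : ℕ → Term
    app  : Term → Term → Term          -- app V T : T applied to V
    bind : BKind → Term → Term → Term  -- bind lam W T = λx:W.T ; bind dfn V T = def(x=V).T
    cast : Term → Term → Term

  data Env : Set where
    ∅     : Env
    _,_∶_ : Env → BKind → Term → Env   -- K , lam ∶ W = K,x:W ; K , dfn ∶ V = K,x=V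

  lift : ℕ → Term → Term
  lift c (sort s)     = sort s
  lift c (var i)      = if i <ᵇ c then var i else var (suc i)
  lift c (app V T)    = app (lift c V) (lift c T)
  lift c (bind b V T) = bind b (lift c V) (lift (suc c) T)
  lift c (cast U T)   = cast (lift c U) (lift c T)

  data _⊢_⇒[_]_ : Env → Term → ℕ → Term → Set where
    beta   : ∀ {L V W T} → L ⊢ app V (bind lam W T) ⇒[ 0 ] bind dfn (cast W V) T
    delta  : ∀ {K V} → (K , dfn ∶ V) ⊢ var 0 ⇒[ 0 ] lift 0 V
    zeta   : ∀ {L V T} → L ⊢ bind dfn V (lift 0 T) ⇒[ 0 ] T
    theta  : ∀ {L V W T} → L ⊢ app V (bind dfn W T) ⇒[ 0 ] bind dfn W (app (lift 0 V) T)
    epsilon : ∀ {L U T} → L ⊢ cast U T ⇒[ 0 ] T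
    sortS  : ∀ {L s} → L ⊢ sort s ⇒[ 1 ] sort (next s)
    ldelta : ∀ {K W} → (K , lam ∶ W) ⊢ var 0 ⇒[ 1 ] lift 0 W
    ee     : ∀ {L U T} → L ⊢ cast U T ⇒[ 1 ] U
    lref   : ∀ {K i n T b V} → K ⊢ var i ⇒[ n ] T → (K , b ∶ V) ⊢ var (suc i) ⇒[ n ] lift 0 T
    appl   : ∀ {L V₁ V₂ T} → L ⊢ V₁ ⇒[ 0 ] V₂ → L ⊢ app V₁ T ⇒[ 0 ] app V₂ T
    appr   : ∀ {L V T₁ T₂ n} → L ⊢ T₁ ⇒[ n ] T₂ → L ⊢ app V T₁ ⇒[ n ] app V T₂
    bindl  : ∀ {L b V₁ V₂ T} → L ⊢ V₁ ⇒[ 0 ] V₂ → L ⊢ bind b V₁ T ⇒[ 0 ] bind b V₂ T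
    bindr  : ∀ {L b V T₁ T₂ n} → (L , b ∶ V) ⊢ T₁ ⇒[ n ] T₂ → L ⊢ bind b V T₁ ⇒[ n ] bind b V T₂
    castl  : ∀ {L U₁ U₂ T} → L ⊢ U₁ ⇒[ 0 ] U₂ → L ⊢ cast U₁ T ⇒[ 0 ] cast U₂ T
    castr  : ∀ {L U T₁ T₂} → L ⊢ T₁ ⇒[ 0 ] T₂ → L ⊢ cast U T₁ ⇒[ 0 ] cast U T₂
    castb  : ∀ {L U₁ U₂ T₁ T₂} → L ⊢ U₁ ⇒[ 1 ] U₂ → L ⊢ T₁ ⇒[ 1 ] T₂
           → L ⊢ cast U₁ T₁ ⇒[ 1 ] cast U₂ T₂

  data _⊢_⇒*[_]_ : Env → Term → ℕ → Term → Set where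
    refl* : ∀ {L T} → L ⊢ T ⇒*[ 0 ] T
    step* : ∀ {L T₁ T₂ n} → L ⊢ T₁ ⇒[ n ] T₂ → L ⊢ T₁ ⇒*[ n ] T₂
    trans* : ∀ {L T₁ T T₂ n₁ n₂} → L ⊢ T₁ ⇒*[ n₁ ] T → L ⊢ T ⇒*[ n₂ ] T₂
           → L ⊢ T₁ ⇒*[ n₁ + n₂ ] T₂

  data Valid (𝒜 : ℕ → Set) : Env → Term → Set where
    v-sort : ∀ {L s} → Valid 𝒜 L (sort s)
    v-var0 : ∀ {K b V} → Valid 𝒜 K V → Valid 𝒜 (K , b ∶ V) (var 0)
    v-varS : ∀ {K i b V} → Valid 𝒜 K (var i) → Valid 𝒜 (K , b ∶ V) (var (suc i))
    v-bind : ∀ {L b V T} → Valid 𝒜 L V → Valid 𝒜 (L , b ∶ V) T → Valid 𝒜 L (bind b V T)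
    v-cast : ∀ {L U T U₀} → Valid 𝒜 L U → Valid 𝒜 L T
           → L ⊢ T ⇒*[ 1 ] U₀ → L ⊢ U ⇒*[ 0 ] U₀ → Valid 𝒜 L (cast U T)
    v-app  : ∀ {L V T n W₀ U₀} → Valid 𝒜 L V → Valid 𝒜 L T → 𝒜 n
           → L ⊢ T ⇒*[ n ] bind lam W₀ U₀ → L ⊢ V ⇒*[ 1 ] W₀ → Valid 𝒜 L (app V T)

  Typed : (ℕ → Set) → Env → Term → Term → Set
  Typed 𝒜 L T U = Valid 𝒜 L (cast U T)

  data Arity : Set where
    ○   : Arity
    _⇒_ : Arity → Arity → Arity

  data _⊢_∷∷_ : Env → Term → Arity → Set where
    a-sort : ∀ {L s} → L ⊢ sort s ∷∷ ○
    a-var0 : ∀ {K b V A} → K ⊢ V ∷∷ A → (K , b ∶ V) ⊢ var 0 ∷∷ A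
    a-varS : ∀ {K i b V A} → K ⊢ var i ∷∷ A → (K , b ∶ V) ⊢ var (suc i) ∷∷ A
    a-lam  : ∀ {L W T A B} → L ⊢ W ∷∷ B → (L , lam ∶ W) ⊢ T ∷∷ A → L ⊢ bind lam W T ∷∷ (B ⇒ A)
    a-dfn  : ∀ {L V T A B} → L ⊢ V ∷∷ B → (L , dfn ∶ V) ⊢ T ∷∷ A → L ⊢ bind dfn V T ∷∷ A
    a-app  : ∀ {L V T A B} → L ⊢ V ∷∷ B → L ⊢ T ∷∷ (B ⇒ A) → L ⊢ app V T ∷∷ A
    a-cast : ∀ {L U T A} → L ⊢ U ∷∷ A → L ⊢ T ∷∷ A → L ⊢ cast U T ∷∷ A

module Submission where

-- The typing judgment is validity of  cast U T, and validity of
-- cast U T requires  L ⊢ T →*¹ U₀  and  L ⊢ U →*⁰ U₀  for some U₀.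
-- So it suffices to show that every valid term has an arity
-- (arity-of-valid), which in turn rests on two facts about arity
-- assignment:
--   * uniqueness: a term has at most one arity in a given environment;
--   * preservation: rt-reduction (of any depth n) preserves arities.
-- Preservation is proved one step at a time; its interesting cases are
--   δ/ldelta and lref, which need weakening (lift preserves arities),
--   ζ, which needs strengthening (the converse of weakening), and
--   β and bindl, which replace an environment entry by another entry of
--   the same arity (transport along "arity-simulating" environments).
-- The arity of cast U T is the arity shared by U and T, which is
-- exactly the pair the theorem asks for.

open import Defs
open import Data.Nat using (ℕ; zero; suc; _<ᵇ_)
open import Data.Bool using (true; false)
open import Data.Product using (Σ; _×_; _,_)
open import Relation.Binary.Definitions using (DecidableEquality)
open import Relation.Binary.PropositionalEquality using (_≡_; refl; cong)

module ArityTheory (S : Set) (next : S → S) where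
  open Lang S next

  -- Arities are unique: arity assignment is syntax-directed.
  arity-unique : ∀ {L T A B} → L ⊢ T ∷∷ A → L ⊢ T ∷∷ B → A ≡ B
  arity-unique a-sort        a-sort        = refl
  arity-unique (a-var0 d)    (a-var0 e)    = arity-unique d e
  arity-unique (a-varS d)    (a-varS e)    = arity-unique d e
  arity-unique (a-lam dW dT) (a-lam eW eT)
    with refl ← arity-unique dW eW | refl ← arity-unique dT eT = refl
  arity-unique (a-dfn _ dT)  (a-dfn _ eT)  = arity-unique dT eT
  arity-unique (a-app dV dT) (a-app eV eT)
    with refl ← arity-unique dV eV | refl ← arity-unique dT eT = refl
  arity-unique (a-cast dU _) (a-cast eU _) = arity-unique dU eU

  arity-transfer : ∀ {L T T′ A} → L ⊢ T ∷∷ A → L ⊢ T′ ∷∷ A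
                 → ∀ {B} → L ⊢ T ∷∷ B → L ⊢ T′ ∷∷ B
  arity-transfer dT dT′ eT with refl ← arity-unique dT eT = dT′

  -- Arity assignment only looks at entries' arities.
  data _≼_ : Env → Env → Set where
    ∅≼∅ : ∅ ≼ ∅
    _,≼_ : ∀ {K K′ b b′ V V′} → K ≼ K′ → (∀ {A} → K ⊢ V ∷∷ A → K′ ⊢ V′ ∷∷ A)
         → (K , b ∶ V) ≼ (K′ , b′ ∶ V′)

  ≼-refl : ∀ {L} → L ≼ L
  ≼-refl {∅}         = ∅≼∅
  ≼-refl {L , b ∶ V} = ≼-refl ,≼ (λ d → d)

  arity-≼ : ∀ {L L′ A} (T : Term) → L ≼ L′ → L ⊢ T ∷∷ A → L′ ⊢ T ∷∷ A
  arity-≼ (sort s)       e         a-sort        = a-sort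
  arity-≼ (var zero)     (e ,≼ f)  (a-var0 d)    = a-var0 (f d)
  arity-≼ (var (suc i))  (e ,≼ f)  (a-varS d)    = a-varS (arity-≼ (var i) e d)
  arity-≼ (bind lam W T) e         (a-lam dW dT) =
    a-lam (arity-≼ W e dW) (arity-≼ T (e ,≼ arity-≼ W e) dT)
  arity-≼ (bind dfn V T) e         (a-dfn dV dT) =
    a-dfn (arity-≼ V e dV) (arity-≼ T (e ,≼ arity-≼ V e) dT)
  arity-≼ (app V T)      e         (a-app dV dT) = a-app (arity-≼ V e dV) (arity-≼ T e dT)
  arity-≼ (cast U T)     e         (a-cast dU dT) = a-cast (arity-≼ U e dU) (arity-≼ T e dT)

  -- Insert c L L′: L′ is L with one new entry inserted below its last c
  -- entries, those entries being lifted accordingly.  This is the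
  -- environment in which  lift c T  lives when T lives in L.
  data Insert : ℕ → Env → Env → Set where
    here  : ∀ {K b V} → Insert 0 K (K , b ∶ V)
    under : ∀ {c K K′ b V} → Insert c K K′ → Insert (suc c) (K , b ∶ V) (K′ , b ∶ lift c V)

  liftIndex : ℕ → ℕ → ℕ
  liftIndex zero    i       = suc i
  liftIndex (suc c) zero    = zero
  liftIndex (suc c) (suc i) = suc (liftIndex c i)

  -- Successor on variables (other terms are left alone); lifting at
  -- cutoff suc c acts on var (suc i) as shiftVar ∘ (lifting at c) on var i.
  shiftVar : Term → Term
  shiftVar (var j) = var (suc j)
  shiftVar t       = t

  lift-var : ∀ c i → lift c (var i) ≡ var (liftIndex c i)
  lift-var zero    i       = refl
  lift-var (suc c) zero    = refl
  lift-var (suc c) (suc i) with i <ᵇ c | lift-var c i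
  ... | true  | e = cong shiftVar e
  ... | false | e = cong shiftVar e

  mutual
    weaken : ∀ {c L L′ A} (T : Term) → Insert c L L′ → L ⊢ T ∷∷ A → L′ ⊢ lift c T ∷∷ A
    weaken (sort s)       ins a-sort        = a-sort
    weaken {c} (var i)    ins d rewrite lift-var c i = weaken-var ins d
    weaken (bind lam W T) ins (a-lam dW dT) = a-lam (weaken W ins dW) (weaken T (under ins) dT)
    weaken (bind dfn V T) ins (a-dfn dV dT) = a-dfn (weaken V ins dV) (weaken T (under ins) dT)
    weaken (app V T)      ins (a-app dV dT) = a-app (weaken V ins dV) (weaken T ins dT)
    weaken (cast U T)     ins (a-cast dU dT) = a-cast (weaken U ins dU) (weaken T ins dT)

    weaken-var : ∀ {c L L′ A i} → Insert c L L′ → L ⊢ var i ∷∷ A → L′ ⊢ var (liftIndex c i) ∷∷ A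
    weaken-var here                  d          = a-varS d
    weaken-var (under {V = V} ins)   (a-var0 d) = a-var0 (weaken V ins d)
    weaken-var (under ins)           (a-varS d) = a-varS (weaken-var ins d)

  mutual
    strengthen : ∀ {c L L′ A} (T : Term) → Insert c L L′ → L′ ⊢ lift c T ∷∷ A → L ⊢ T ∷∷ A
    strengthen (sort s)       ins a-sort        = a-sort
    strengthen {c} (var i)    ins d rewrite lift-var c i = strengthen-var i ins d
    strengthen (bind lam W T) ins (a-lam dW dT) = a-lam (strengthen W ins dW) (strengthen T (under ins) dT)
    strengthen (bind dfn V T) ins (a-dfn dV dT) = a-dfn (strengthen V ins dV) (strengthen T (under ins) dT)
    strengthen (app V T)      ins (a-app dV dT) = a-app (strengthen V ins dV) (strengthen T ins dT)
    strengthen (cast U T)     ins (a-cast dU dT) = a-cast (strengthen U ins dU) (strengthen T ins dT)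

    -- The variable case: a shifted index is never the inserted entry.
    strengthen-var : ∀ {c L L′ A} i → Insert c L L′ → L′ ⊢ var (liftIndex c i) ∷∷ A → L ⊢ var i ∷∷ A
    strengthen-var i       here                (a-varS d) = d
    strengthen-var zero    (under {V = V} ins) (a-var0 d) = a-var0 (strengthen V ins d)
    strengthen-var (suc i) (under ins)         (a-varS d) = a-varS (strengthen-var i ins d)

  preserve : ∀ {L T T′ n A} → L ⊢ T ⇒[ n ] T′ → L ⊢ T ∷∷ A → L ⊢ T′ ∷∷ A
  preserve (beta {T = T}) (a-app dV (a-lam dW dT)) =
    a-dfn dWV (arity-≼ T (≼-refl ,≼ arity-transfer dW dWV) dT)
    where dWV = a-cast dW dV
  preserve (delta {V = V})     (a-var0 d)     = weaken V here d
  preserve (zeta {T = T})      (a-dfn _ dT)   = strengthen T here dT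
  preserve (theta {V = V})     (a-app dV (a-dfn dW dT)) = a-dfn dW (a-app (weaken V here dV) dT)
  preserve epsilon             (a-cast _ dT)  = dT
  preserve sortS               a-sort         = a-sort
  preserve (ldelta {W = W})    (a-var0 d)     = weaken W here d
  preserve ee                  (a-cast dU _)  = dU
  preserve (lref {T = T} r)    (a-varS d)     = weaken T here (preserve r d)
  preserve (appl r)            (a-app dV dT)  = a-app (preserve r dV) dT
  preserve (appr r)            (a-app dV dT)  = a-app dV (preserve r dT)
  preserve (bindl {T = T} r)   (a-lam dW dT)  = a-lam (preserve r dW) (arity-≼ T (≼-refl ,≼ preserve r) dT)
  preserve (bindl {T = T} r)   (a-dfn dV dT)  = a-dfn (preserve r dV) (arity-≼ T (≼-refl ,≼ preserve r) dT)
  preserve (bindr r)           (a-lam dW dT)  = a-lam dW (preserve r dT)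
  preserve (bindr r)           (a-dfn dV dT)  = a-dfn dV (preserve r dT)
  preserve (castl r)           (a-cast dU dT) = a-cast (preserve r dU) dT
  preserve (castr r)           (a-cast dU dT) = a-cast dU (preserve r dT)
  preserve (castb rU rT)       (a-cast dU dT) = a-cast (preserve rU dU) (preserve rT dT)

  preserve* : ∀ {L T T′ n A} → L ⊢ T ⇒*[ n ] T′ → L ⊢ T ∷∷ A → L ⊢ T′ ∷∷ A
  preserve* refl*         d = d
  preserve* (step* r)     d = preserve r d
  preserve* (trans* r r′) d = preserve* r′ (preserve* r d)

  joinable-arity : ∀ {L T U T₀ m n A B} → L ⊢ T ⇒*[ m ] T₀ → L ⊢ U ⇒*[ n ] T₀
                 → L ⊢ T ∷∷ A → L ⊢ U ∷∷ B → A ≡ B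
  joinable-arity rT rU dT dU = arity-unique (preserve* rT dT) (preserve* rU dU)

  -- Every valid term has an arity.  The side conditions of v-cast and
  -- v-app are what make the arities of the two subterms fit together.
  arity-of-valid : ∀ {𝒜 L T} → Valid 𝒜 L T → Σ Arity (λ A → L ⊢ T ∷∷ A)
  arity-of-valid v-sort = ○ , a-sort
  arity-of-valid (v-var0 v) with A , d ← arity-of-valid v = A , a-var0 d
  arity-of-valid (v-varS v) with A , d ← arity-of-valid v = A , a-varS d
  arity-of-valid (v-bind {b = lam} vW vT)
    with B , dW ← arity-of-valid vW | A , dT ← arity-of-valid vT = (B ⇒ A) , a-lam dW dT
  arity-of-valid (v-bind {b = dfn} vV vT)
    with _ , dV ← arity-of-valid vV | A , dT ← arity-of-valid vT = A , a-dfn dV dT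
  arity-of-valid (v-cast vU vT rT rU)
    with A , dU ← arity-of-valid vU | _ , dT ← arity-of-valid vT
    with refl ← joinable-arity rU rT dU dT = A , a-cast dU dT
  arity-of-valid (v-app vV vT _ rT rV)
    with _ , dV ← arity-of-valid vV | _ , dT ← arity-of-valid vT
    -- T reduces to an abstraction λx:W₀, whose arity is  B₀ ⇒ A  with B₀
    -- the arity of W₀, a reduct of V.
    with a-lam dW₀ _ ← preserve* rT dT
    with refl ← arity-unique (preserve* rV dV) dW₀ = _ , a-app dV dT

theorem5p4 : (S : Set) → DecidableEquality S → S → (next : S → S) →
    let open Lang S next in
    (𝒜 : ℕ → Set) (L : Env) (T U : Term) →
    Typed 𝒜 L T U → Σ Arity (λ A → (L ⊢ T ∷∷ A) × (L ⊢ U ∷∷ A))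
theorem5p4 S _ _ next 𝒜 L T U typed
  with A , Lang.a-cast dU dT ← ArityTheory.arity-of-valid S next typed = A , dT , dU
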